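{- Let $M$ be an $m\times n$ grid graph with $m,n\geq 3$ and positive integer node weights of total weight $W$, and suppose no node has weight larger than $W/2$. If $(V_0^*,V_1^*)$ is a connected bipartition maximizing $\min\{w(V_0),w(V_1)\}$ over all connected bipartitions $(V_0,V_1)$ of $M$, then $\min\{w(V_0^*),w(V_1^*)\}\geq W/3$.
   Context: The grid graph has node set $\{M_{ij}\}$ with edges between nodes consecutive in a row or a column. $w(S)$ is the total weight of $S$. A connected bipartition is a partition of the node set into two nonempty parts each inducing a connected subgraph. -}

module Defs where

open import Data.Nat using (ℕ; zero; suc; _+_; _*_; _≤_; _⊓_)
open import Data.Fin using (Fin; toℕ)
open import Data.Bool using (Bool; true; false; not)
open import Data.Product using (_×_; _,_; ∃; ∃-syntax)
open import Data.Sum using (_⊎_)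
open import Relation.Binary.PropositionalEquality using (_≡_)

Node : ℕ → ℕ → Set
Node m n = Fin m × Fin n

Consec : ℕ → ℕ → Set
Consec a b = suc a ≡ b ⊎ suc b ≡ a

Adj : ∀ {m n} → Node m n → Node m n → Set
Adj (i , j) (i' , j') = (i ≡ i' × Consec (toℕ j) (toℕ j')) ⊎ (j ≡ j' × Consec (toℕ i) (toℕ i'))

Subset : ℕ → ℕ → Set
Subset m n = Node m n → Bool

complement : ∀ {m n} → Subset m n → Subset m n
complement S v = not (S v)

_∈_ : ∀ {m n} → Node m n → Subset m n → Set
v ∈ S = S v ≡ true

data Walk {m n} (S : Subset m n) : Node m n → Node m n → Set where
  here : ∀ {a} → a ∈ S → Walk S a a
  step : ∀ {a b c} → a ∈ S → Adj a b → Walk S b c → Walk S a c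

Connected : ∀ {m n} → Subset m n → Set
Connected S = ∀ a b → a ∈ S → b ∈ S → Walk S a b

NonEmpty : ∀ {m n} → Subset m n → Set
NonEmpty S = ∃[ v ] v ∈ S

ConnectedBipartition : ∀ {m n} → Subset m n → Set
ConnectedBipartition S =
  NonEmpty S × NonEmpty (complement S) × Connected S × Connected (complement S)

sumFin : ∀ k → (Fin k → ℕ) → ℕ
sumFin zero f = 0
sumFin (suc k) f = f Fin.zero + sumFin k (λ i → f (Fin.suc i))
  where import Data.Fin as Fin

Weights : ℕ → ℕ → Set
Weights m n = Node m n → ℕ

total : ∀ {m n} → Weights m n → ℕ
total {m} {n} w = sumFin m (λ i → sumFin n (λ j → w (i , j)))

weightOf : ∀ {m n} → Weights m n → Subset m n → ℕ
weightOf {m} {n} w S =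
  sumFin m (λ i → sumFin n (λ j → if S (i , j) then w (i , j) else 0))
  where open import Data.Bool using (if_then_else_)

minWeight : ∀ {m n} → Weights m n → Subset m n → ℕ
minWeight w S = weightOf w S ⊓ weightOf w (complement S)

module Submission where

-- It suffices to exhibit one connected bipartition with both parts ≥ W/3.
-- Order the nodes row by row (rank).  Every prefix {rank < k} is connected
-- (each member walks back to the origin along its row, then up the first
-- column), and so is its complement (walking forward to the corner); a single
-- node is connected, and on a grid with at least two rows and columns so is
-- its complement, since some vertical edge jumps over any removed node.
-- Let p(k) be the weight of the k-th prefix and take the k where 3·p first
-- reaches W.  If 3·p(k+1) ≤ 2W the prefix of length k+1 is balanced;
-- otherwise the node of rank k weighs more than W/3 and, weighing at most
-- W/2, leaves at least W/3 outside: that node and the rest are balanced.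

open import Defs
open import Data.Nat.Properties
open import Algebra.Properties.CommutativeMonoid.Sum +-0-commutativeMonoid
  using (sum; sum-cong-≗; ∑-distrib-+; sum-replicate-zero; sum-remove)
open import Data.Bool using (true; false; not; if_then_else_)
open import Data.Fin using (Fin; toℕ; punchIn; fromℕ<; fromℕ; combine; remQuot) renaming (zero to fz; suc to fs)
open import Data.Fin.Properties
  using (punchInᵢ≢i; toℕ-injective; toℕ-fromℕ<; toℕ<n; toℕ-fromℕ; toℕ≤pred[n]; toℕ-combine; remQuot-combine; combine-remQuot)
open import Data.Nat using (ℕ; zero; suc; _+_; _∸_; _*_; _≤_; _<_; z≤n; s≤s; s≤s⁻¹; z<s; _<?_; _≤?_; _≟_; _⊓_)
open import Data.Product using (_,_; proj₁; proj₂; uncurry; ∃-syntax; _×_)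
open import Data.Sum using (inj₁; inj₂)
open import Function using (_∘_)
open import Relation.Nullary using (¬_; Dec; yes; no; does; contradiction)
open import Relation.Binary.Definitions using (Tri; tri<; tri≈; tri>)
open import Relation.Nullary.Decidable using (dec-true; dec-false)
open import Relation.Binary.PropositionalEquality

adj-sym : ∀ {m n} {a b : Node m n} → Adj a b → Adj b a
adj-sym (inj₁ (e , inj₁ c)) = inj₁ (sym e , inj₂ c)
adj-sym (inj₁ (e , inj₂ c)) = inj₁ (sym e , inj₁ c)
adj-sym (inj₂ (e , inj₁ c)) = inj₂ (sym e , inj₂ c)
adj-sym (inj₂ (e , inj₂ c)) = inj₂ (sym e , inj₁ c)

module _ {m n} {S : Subset m n} where

  walk-start : ∀ {a b} → Walk S a b → a ∈ S
  walk-start (here a∈S) = a∈S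
  walk-start (step a∈S _ _) = a∈S

  infixr 5 _++ʷ_
  _++ʷ_ : ∀ {a b c} → Walk S a b → Walk S b c → Walk S a c
  here _ ++ʷ q = q
  step a∈S ab p ++ʷ q = step a∈S ab (p ++ʷ q)

  reverseʷ : ∀ {a b} → Walk S a b → Walk S b a
  reverseʷ (here a∈S) = here a∈S
  reverseʷ (step a∈S ab p) = reverseʷ p ++ʷ step (walk-start p) (adj-sym ab) (here a∈S)

sumFin≡sum : ∀ k (f : Fin k → ℕ) → sumFin k f ≡ sum f
sumFin≡sum zero f = refl
sumFin≡sum (suc k) f = cong (f fz +_) (sumFin≡sum k (λ i → f (fs i)))

sumFin-cong : ∀ k {f g : Fin k → ℕ} → (∀ i → f i ≡ g i) → sumFin k f ≡ sumFin k g
sumFin-cong k {f} {g} f≗g = begin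
  sumFin k f ≡⟨ sumFin≡sum k f ⟩
  sum f      ≡⟨ sum-cong-≗ f≗g ⟩
  sum g      ≡⟨ sumFin≡sum k g ⟨
  sumFin k g ∎
  where open ≡-Reasoning

sumFin-+ : ∀ k (f g : Fin k → ℕ) → sumFin k (λ i → f i + g i) ≡ sumFin k f + sumFin k g
sumFin-+ k f g = begin
  sumFin k (λ i → f i + g i) ≡⟨ sumFin≡sum k _ ⟩
  sum (λ i → f i + g i)      ≡⟨ ∑-distrib-+ f g ⟩
  sum f + sum g              ≡⟨ cong₂ _+_ (sumFin≡sum k f) (sumFin≡sum k g) ⟨
  sumFin k f + sumFin k g    ∎
  where open ≡-Reasoning

sumFin-zero : ∀ k (f : Fin k → ℕ) → (∀ i → f i ≡ 0) → sumFin k f ≡ 0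
sumFin-zero zero f zeros = refl
sumFin-zero (suc k) f zeros = cong₂ _+_ (zeros fz) (sumFin-zero k (f ∘ fs) (zeros ∘ fs))

sumFin-single : ∀ k (f : Fin k → ℕ) (i₀ : Fin k) → (∀ i → i ≢ i₀ → f i ≡ 0) → sumFin k f ≡ f i₀
sumFin-single (suc k) f i₀ vanish = begin
  sumFin (suc k) f                   ≡⟨ sumFin≡sum (suc k) f ⟩
  sum f                              ≡⟨ sum-remove {i = i₀} f ⟩
  f i₀ + sum {k} (f ∘ punchIn i₀)    ≡⟨ cong (f i₀ +_) (sum-cong-≗ (λ i → vanish _ (punchInᵢ≢i i₀ i))) ⟩
  f i₀ + sum {k} (λ _ → 0)           ≡⟨ cong (f i₀ +_) (sum-replicate-zero k) ⟩
  f i₀ + 0                           ≡⟨ +-identityʳ (f i₀) ⟩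
  f i₀                               ∎
  where open ≡-Reasoning

module _ {m n} (w : Weights m n) where

  share : Subset m n → Node m n → ℕ
  share S u = if S u then w u else 0

  weight-split : (S A B : Subset m n) → (∀ u → share S u ≡ share A u + share B u)
               → weightOf w S ≡ weightOf w A + weightOf w B
  weight-split S A B split =
    trans (sumFin-cong m (λ i → trans (sumFin-cong n (λ j → split (i , j))) (sumFin-+ n _ _)))
          (sumFin-+ m _ _)

  weight-complement : (S : Subset m n) → weightOf w S + weightOf w (complement S) ≡ total w
  weight-complement S = sym (weight-split (λ _ → true) S (complement S) (λ u → split (S u) (w u)))
    where
    split : ∀ b x → x ≡ (if b then x else 0) + (if not b then x else 0)
    split true x = sym (+-identityʳ x)
    split false x = refl

  weight-full : (S : Subset m n) → (∀ u → u ∈ S) → weightOf w S ≡ total w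
  weight-full S all =
    sumFin-cong m (λ i → sumFin-cong n (λ j → cong (λ b → if b then w (i , j) else 0) (all (i , j))))

  weight-empty : (S : Subset m n) → (∀ u → S u ≡ false) → weightOf w S ≡ 0
  weight-empty S none =
    sumFin-zero m _ (λ i → sumFin-zero n _ (λ j → cong (λ b → if b then w (i , j) else 0) (none (i , j))))

  weight-single : (S : Subset m n) (v : Node m n) → (∀ u → u ∈ S → u ≡ v) → v ∈ S → weightOf w S ≡ w v
  weight-single S v@(i₀ , j₀) only-v v∈S =
    trans (sumFin-single m _ i₀ (λ i i≢i₀ → sumFin-zero n _ (λ j → outside (i , j) (i≢i₀ ∘ cong proj₁))))
          (trans (sumFin-single n _ j₀ (λ j j≢j₀ → outside (i₀ , j) (j≢j₀ ∘ cong proj₂)))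
                 (cong (λ b → if b then w v else 0) v∈S))
    where
    outside : ∀ u → u ≢ v → share S u ≡ 0
    outside u u≢v with S u in u∈S
    ... | true = contradiction (only-v u u∈S) u≢v
    ... | false = refl

module _ {m n} {P : Node m n → Set} (P? : ∀ u → Dec (P u)) where

  setOf : Subset m n
  setOf u = does (P? u)

  setOf-intro : ∀ u → P u → u ∈ setOf
  setOf-intro u p = dec-true (P? u) p

  setOf-elim : ∀ u → u ∈ setOf → P u
  setOf-elim u u∈ with P? u
  ... | yes p = p

  setOfᶜ-intro : ∀ u → ¬ P u → u ∈ complement setOf
  setOfᶜ-intro u ¬p = cong not (dec-false (P? u) ¬p)

  setOfᶜ-elim : ∀ u → u ∈ complement setOf → ¬ P u
  setOfᶜ-elim u u∉ with P? u
  ... | no ¬p = ¬p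

rowAdj : ∀ {m n} (i : Fin m) (a b : Fin n) → suc (toℕ a) ≡ toℕ b → Adj (i , a) (i , b)
rowAdj i a b a+1≡b = inj₁ (refl , inj₁ a+1≡b)

columnAdj : ∀ {m n} (j : Fin n) (a b : Fin m) → suc (toℕ a) ≡ toℕ b → Adj (a , j) (b , j)
columnAdj j a b a+1≡b = inj₂ (refl , inj₁ a+1≡b)

≤last : ∀ {k} (c : Fin (suc k)) → toℕ c ≤ toℕ (fromℕ k)
≤last {k} c = subst (toℕ c ≤_) (sym (toℕ-fromℕ k)) (toℕ≤pred[n] c)

lineWalk : ∀ {m n k} (S : Subset m n) (line : Fin k → Node m n)
         → (∀ a b → suc (toℕ a) ≡ toℕ b → Adj (line a) (line b))
         → (a b : Fin k) → toℕ a ≤ toℕ b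
         → (∀ c → toℕ a ≤ toℕ c → toℕ c ≤ toℕ b → line c ∈ S)
         → Walk S (line a) (line b)
lineWalk {k = k} S line adjacent a b a≤b inS = go (toℕ b ∸ toℕ a) a (sym (m∸n+n≡m a≤b)) inS
  where
  go : ∀ d a → toℕ b ≡ d + toℕ a → (∀ c → toℕ a ≤ toℕ c → toℕ c ≤ toℕ b → line c ∈ S)
     → Walk S (line a) (line b)
  go zero a b≡a inS with refl ← toℕ-injective b≡a = here (inS a ≤-refl ≤-refl)
  go (suc d) a b≡d+1+a inS =
    step (inS a ≤-refl (<⇒≤ a<b)) (adjacent a next (sym (toℕ-fromℕ< next<k)))
         (go d next b≡d+next (λ c next≤c c≤b → inS c (<⇒≤ (<-≤-trans a<next next≤c)) c≤b))
    where
    a<b : toℕ a < toℕ b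
    a<b = subst (toℕ a <_) (sym b≡d+1+a) (s≤s (m≤n+m (toℕ a) d))
    next<k : suc (toℕ a) < k
    next<k = ≤-<-trans a<b (toℕ<n b)
    next : Fin k
    next = fromℕ< next<k
    a<next : toℕ a < toℕ next
    a<next = subst (toℕ a <_) (sym (toℕ-fromℕ< next<k)) ≤-refl
    b≡d+next : toℕ b ≡ d + toℕ next
    b≡d+next = trans b≡d+1+a (trans (sym (+-suc d (toℕ a))) (cong (d +_) (sym (toℕ-fromℕ< next<k))))

module Grid (m′ n′ : ℕ) where

  m n N : ℕ
  m = suc m′
  n = suc n′
  N = m * n

  rank : Node m n → ℕ
  rank (i , j) = n * toℕ i + toℕ j

  rank≡combine : ∀ u → rank u ≡ toℕ (uncurry combine u)
  rank≡combine (i , j) = sym (toℕ-combine i j)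

  rank<N : ∀ u → rank u < N
  rank<N u = subst (_< N) (sym (rank≡combine u)) (toℕ<n _)

  rank-injective : ∀ u v → rank u ≡ rank v → u ≡ v
  rank-injective u v ru≡rv = begin
    u                             ≡⟨ remQuot-combine (proj₁ u) (proj₂ u) ⟨
    remQuot n (uncurry combine u) ≡⟨ cong (remQuot n) (toℕ-injective same-cell) ⟩
    remQuot n (uncurry combine v) ≡⟨ remQuot-combine (proj₁ v) (proj₂ v) ⟩
    v                             ∎
    where
    open ≡-Reasoning
    same-cell : toℕ (uncurry combine u) ≡ toℕ (uncurry combine v)
    same-cell = trans (sym (rank≡combine u)) (trans ru≡rv (rank≡combine v))

  nodeAt : ∀ k → k < N → Node m n
  nodeAt k k<N = remQuot n (fromℕ< k<N)

  rank-nodeAt : ∀ k k<N → rank (nodeAt k k<N) ≡ k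
  rank-nodeAt k k<N = begin
    rank (nodeAt k k<N)                            ≡⟨ rank≡combine (nodeAt k k<N) ⟩
    toℕ (uncurry combine (remQuot n (fromℕ< k<N))) ≡⟨ cong toℕ (combine-remQuot n (fromℕ< k<N)) ⟩
    toℕ (fromℕ< k<N)                               ≡⟨ toℕ-fromℕ< k<N ⟩
    k                                              ∎
    where open ≡-Reasoning

  origin corner : Node m n
  origin = fz , fz
  corner = fromℕ m′ , fromℕ n′

  rank-origin : rank origin ≡ 0
  rank-origin = trans (+-identityʳ (n * 0)) (*-zeroʳ n)

  below : ∀ u → rank u + n < N → ∃[ v ] (Adj u v × rank v ≡ rank u + n)
  below (i , j) lt = (fromℕ< i+1<m , j) , inj₂ (refl , inj₁ (sym (toℕ-fromℕ< i+1<m))) , rank-below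
    where
    open ≤-Reasoning
    i+1<m : suc (toℕ i) < m
    i+1<m = *-cancelˡ-< n (suc (toℕ i)) m (begin-strict
      n * suc (toℕ i)          ≡⟨ *-suc n (toℕ i) ⟩
      n + n * toℕ i            ≤⟨ +-monoʳ-≤ n (m≤m+n (n * toℕ i) (toℕ j)) ⟩
      n + (n * toℕ i + toℕ j)  ≡⟨ +-comm n _ ⟩
      n * toℕ i + toℕ j + n    <⟨ lt ⟩
      m * n                    ≡⟨ *-comm m n ⟩
      n * m                    ∎)
    rank-below : n * toℕ (fromℕ< i+1<m) + toℕ j ≡ n * toℕ i + toℕ j + n
    rank-below = begin-equality
      n * toℕ (fromℕ< i+1<m) + toℕ j ≡⟨ cong (λ r → n * r + toℕ j) (toℕ-fromℕ< i+1<m) ⟩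
      n * suc (toℕ i) + toℕ j        ≡⟨ cong (_+ toℕ j) (*-suc n (toℕ i)) ⟩
      n + n * toℕ i + toℕ j          ≡⟨ +-assoc n _ _ ⟩
      n + (n * toℕ i + toℕ j)        ≡⟨ +-comm n _ ⟩
      n * toℕ i + toℕ j + n          ∎

  descend : (S : Subset m n) (u : Node m n) → (∀ x → rank x ≤ rank u → x ∈ S) → Walk S u origin
  descend S (i , j) lower∈S = reverseʷ (alongColumn ++ʷ alongRow)
    where
    alongColumn : Walk S (fz , fz) (i , fz)
    alongColumn = lineWalk S (_, fz) (columnAdj fz) fz i z≤n
      (λ r _ r≤i → lower∈S (r , fz) (+-mono-≤ (*-monoʳ-≤ n r≤i) z≤n))
    alongRow : Walk S (i , fz) (i , j)
    alongRow = lineWalk S (i ,_) (rowAdj i) fz j z≤n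
      (λ c _ c≤j → lower∈S (i , c) (+-monoʳ-≤ (n * toℕ i) c≤j))

  ascend : (S : Subset m n) (u : Node m n) → (∀ x → rank u ≤ rank x → x ∈ S) → Walk S u corner
  ascend S (i , j) upper∈S = alongRow ++ʷ alongColumn
    where
    alongRow : Walk S (i , j) (i , fromℕ n′)
    alongRow = lineWalk S (i ,_) (rowAdj i) j (fromℕ n′) (≤last j)
      (λ c j≤c _ → upper∈S (i , c) (+-monoʳ-≤ (n * toℕ i) j≤c))
    alongColumn : Walk S (i , fromℕ n′) corner
    alongColumn = lineWalk S (_, fromℕ n′) (columnAdj (fromℕ n′)) i (fromℕ m′) (≤last i)
      (λ r i≤r _ → upper∈S (r , fromℕ n′) (+-mono-≤ (*-monoʳ-≤ n i≤r) (≤last j)))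

  down-closed⇒connected : (S : Subset m n) → (∀ u → u ∈ S → ∀ x → rank x ≤ rank u → x ∈ S)
                        → Connected S
  down-closed⇒connected S closed a b a∈S b∈S =
    descend S a (closed a a∈S) ++ʷ reverseʷ (descend S b (closed b b∈S))

  up-closed⇒connected : (S : Subset m n) → (∀ u → u ∈ S → ∀ x → rank u ≤ rank x → x ∈ S)
                      → Connected S
  up-closed⇒connected S closed a b a∈S b∈S =
    ascend S a (closed a a∈S) ++ʷ reverseʷ (ascend S b (closed b b∈S))

  below? : ∀ k (u : Node m n) → Dec (rank u < k)
  below? k u = rank u <? k

  at? : ∀ k (u : Node m n) → Dec (rank u ≡ k)
  at? k u = rank u ≟ k

  Prefix Point : ℕ → Subset m n
  Prefix k = setOf (below? k)
  Point k = setOf (at? k)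

  prefix-connected : ∀ k → Connected (Prefix k)
  prefix-connected k = down-closed⇒connected (Prefix k)
    (λ u u∈S x x≤u → setOf-intro (below? k) x (≤-<-trans x≤u (setOf-elim (below? k) u u∈S)))

  prefixᶜ-connected : ∀ k → Connected (complement (Prefix k))
  prefixᶜ-connected k = up-closed⇒connected (complement (Prefix k))
    (λ u u∈S x u≤x → setOfᶜ-intro (below? k) x
                       (λ x<k → setOfᶜ-elim (below? k) u u∈S (≤-<-trans u≤x x<k)))

  point-connected : ∀ k → Connected (Point k)
  point-connected k a b a∈S b∈S = subst (Walk (Point k) a) a≡b (here a∈S)
    where
    a≡b : a ≡ b
    a≡b = rank-injective a b (trans (setOf-elim (at? k) a a∈S) (sym (setOf-elim (at? k) b b∈S)))

  straddling-rank : 2 ≤ m → 2 ≤ n → ∀ k → 0 < k → suc k < N → ∃[ r ] (r < k × k < r + n × r + n < N)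
  straddling-rank m≥2 n≥2 (suc k′) _ k+1<N with k′ + n <? N
  ... | yes k′+n<N = k′ , ≤-refl , k<k′+n , k′+n<N
    where
    k<k′+n : suc k′ < k′ + n
    k<k′+n = subst (suc k′ <_) (+-comm n k′) (+-monoˡ-≤ k′ n≥2)
  ... | no k′+n≮N = r , r<k , subst (suc k′ <_) (sym r+n≡k+1) ≤-refl , subst (_< N) (sym r+n≡k+1) k+1<N
    where
    open ≤-Reasoning
    n≤k′ : n ≤ k′
    n≤k′ = +-cancelʳ-≤ n n k′ (begin
      n + n      ≡⟨ cong (n +_) (+-identityʳ n) ⟨
      2 * n      ≤⟨ *-monoˡ-≤ n m≥2 ⟩
      N          ≤⟨ ≮⇒≥ k′+n≮N ⟩
      k′ + n     ∎)
    r : ℕ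
    r = suc (suc k′) ∸ n
    r+n≡k+1 : r + n ≡ suc (suc k′)
    r+n≡k+1 = m∸n+n≡m (≤-trans n≤k′ (≤-trans (n≤1+n k′) (n≤1+n (suc k′))))
    r<k : r < suc k′
    r<k = s≤s⁻¹ (begin
      2 + r          ≤⟨ +-monoˡ-≤ r n≥2 ⟩
      n + r          ≡⟨ +-comm n r ⟩
      r + n          ≡⟨ r+n≡k+1 ⟩
      suc (suc k′)   ∎)

  vertical-edge : ∀ r → r + n < N → ∃[ x ] ∃[ y ] (rank x ≡ r × rank y ≡ r + n × Adj x y)
  vertical-edge r r+n<N = x , y , rank-x , trans rank-y (cong (_+ n) rank-x) , x~y
    where
    r<N : r < N
    r<N = ≤-<-trans (m≤m+n r n) r+n<N
    x : Node m n
    x = nodeAt r r<N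
    rank-x : rank x ≡ r
    rank-x = rank-nodeAt r r<N
    neighbour : ∃[ y ] (Adj x y × rank y ≡ rank x + n)
    neighbour = below x (subst (λ t → t + n < N) (sym rank-x) r+n<N)
    y : Node m n
    y = proj₁ neighbour
    x~y : Adj x y
    x~y = proj₁ (proj₂ neighbour)
    rank-y : rank y ≡ rank x + n
    rank-y = proj₂ (proj₂ neighbour)

  edge-across : 2 ≤ m → 2 ≤ n → ∀ k → 0 < k → suc k < N → ∃[ x ] ∃[ y ] (rank x < k × k < rank y × Adj x y)
  edge-across m≥2 n≥2 k 0<k k+1<N with straddling-rank m≥2 n≥2 k 0<k k+1<N
  ... | r , r<k , k<r+n , r+n<N with vertical-edge r r+n<N
  ... | x , y , rank-x , rank-y , x~y =
    x , y , subst (_< k) (sym rank-x) r<k , subst (k <_) (sym rank-y) k<r+n , x~y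

  toOrigin-avoiding : ∀ k u → rank u < k → Walk (complement (Point k)) u origin
  toOrigin-avoiding k u u<k = descend (complement (Point k)) u
    (λ x x≤u → setOfᶜ-intro (at? k) x (λ x≡k → <-irrefl x≡k (≤-<-trans x≤u u<k)))

  toCorner-avoiding : ∀ k u → k < rank u → Walk (complement (Point k)) u corner
  toCorner-avoiding k u k<u = ascend (complement (Point k)) u
    (λ x u≤x → setOfᶜ-intro (at? k) x (λ x≡k → <-irrefl (sym x≡k) (<-≤-trans k<u u≤x)))

  across-avoiding : 2 ≤ m → 2 ≤ n → ∀ k → 0 < k → suc k < N → Walk (complement (Point k)) origin corner
  across-avoiding m≥2 n≥2 k 0<k k+1<N with edge-across m≥2 n≥2 k 0<k k+1<N
  ... | x , y , x<k , k<y , x~y =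
    reverseʷ (toOrigin-avoiding k x x<k) ++ʷ
    step (setOfᶜ-intro (at? k) x (λ x≡k → <-irrefl x≡k x<k)) x~y (toCorner-avoiding k y k<y)

  pointᶜ-connected : 2 ≤ m → 2 ≤ n → ∀ k → Connected (complement (Point k))
  pointᶜ-connected m≥2 n≥2 k a b a∈C b∈C = join (<-cmp (rank a) k) (<-cmp (rank b) k)
    where
    join : Tri (rank a < k) (rank a ≡ k) (k < rank a) → Tri (rank b < k) (rank b ≡ k) (k < rank b)
         → Walk (complement (Point k)) a b
    join (tri≈ _ a≡k _) _ = contradiction a≡k (setOfᶜ-elim (at? k) a a∈C)
    join _ (tri≈ _ b≡k _) = contradiction b≡k (setOfᶜ-elim (at? k) b b∈C)
    join (tri< a<k _ _) (tri< b<k _ _) = toOrigin-avoiding k a a<k ++ʷ reverseʷ (toOrigin-avoiding k b b<k)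
    join (tri> _ _ k<a) (tri> _ _ k<b) = toCorner-avoiding k a k<a ++ʷ reverseʷ (toCorner-avoiding k b k<b)
    join (tri< a<k _ _) (tri> _ _ k<b) =
      toOrigin-avoiding k a a<k ++ʷ
      across-avoiding m≥2 n≥2 k (≤-<-trans z≤n a<k) (≤-<-trans k<b (rank<N b)) ++ʷ
      reverseʷ (toCorner-avoiding k b k<b)
    join (tri> _ _ k<a) (tri< b<k _ _) =
      toCorner-avoiding k a k<a ++ʷ
      reverseʷ (across-avoiding m≥2 n≥2 k (≤-<-trans z≤n b<k) (≤-<-trans k<a (rank<N a))) ++ʷ
      reverseʷ (toOrigin-avoiding k b b<k)

  prefix-bipartition : ∀ k → 0 < k → k < N → ConnectedBipartition (Prefix k)
  prefix-bipartition k 0<k k<N =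
    (origin , setOf-intro (below? k) origin (subst (_< k) (sym rank-origin) 0<k)) ,
    (nodeAt k k<N , setOfᶜ-intro (below? k) (nodeAt k k<N) (<-irrefl (rank-nodeAt k k<N))) ,
    prefix-connected k , prefixᶜ-connected k

  point-bipartition : 2 ≤ m → 2 ≤ n → ∀ k → k < N → ConnectedBipartition (Point k)
  point-bipartition m≥2 n≥2 k k<N =
    (nodeAt k k<N , setOf-intro (at? k) (nodeAt k k<N) (rank-nodeAt k k<N)) , other-node k ,
    point-connected k , pointᶜ-connected m≥2 n≥2 k
    where
    1<N : 1 < N
    1<N = *-mono-≤ m≥2 (s≤s z≤n)
    other-node : ∀ k → NonEmpty (complement (Point k))
    other-node zero = nodeAt 1 1<N , setOfᶜ-intro (at? 0) (nodeAt 1 1<N) (1+n≢0 ∘ trans (sym (rank-nodeAt 1 1<N)))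
    other-node (suc k) = origin , setOfᶜ-intro (at? (suc k)) origin (0≢1+n ∘ trans (sym rank-origin))

rest-is-a-third : ∀ a c W → a + c ≡ W → 3 * a ≤ 2 * W → W ≤ 3 * c
rest-is-a-third a c W a+c≡W 3a≤2W = +-cancelˡ-≤ (3 * a) W (3 * c) (begin
  3 * a + W      ≤⟨ +-monoˡ-≤ W 3a≤2W ⟩
  2 * W + W      ≡⟨ +-comm (2 * W) W ⟩
  3 * W          ≡⟨ cong (3 *_) a+c≡W ⟨
  3 * (a + c)    ≡⟨ *-distribˡ-+ 3 a c ⟩
  3 * a + 3 * c  ∎)
  where open ≤-Reasoning

half⇒two-thirds : ∀ a W → 2 * a ≤ W → 3 * a ≤ 2 * W
half⇒two-thirds a W 2a≤W = *-cancelˡ-≤ 2 (begin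
  2 * (3 * a)   ≡⟨ *-assoc 2 3 a ⟨
  6 * a         ≡⟨ *-assoc 3 2 a ⟩
  3 * (2 * a)   ≤⟨ *-monoʳ-≤ 3 2a≤W ⟩
  3 * W         ≤⟨ *-monoˡ-≤ W (n≤1+n 3) ⟩
  4 * W         ≡⟨ *-assoc 2 2 W ⟩
  2 * (2 * W)   ∎)
  where open ≤-Reasoning

jump-is-a-third : ∀ p a W → 3 * p < W → 2 * W < 3 * (p + a) → W ≤ 3 * a
jump-is-a-third p a W 3p<W 2W<3[p+a] = <⇒≤ (+-cancelˡ-< W W (3 * a) (begin-strict
  W + W          ≡⟨ cong (W +_) (+-identityʳ W) ⟨
  2 * W          <⟨ 2W<3[p+a] ⟩
  3 * (p + a)    ≡⟨ *-distribˡ-+ 3 p a ⟩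
  3 * p + 3 * a  <⟨ +-monoˡ-< (3 * a) 3p<W ⟩
  W + 3 * a      ∎))
  where open ≤-Reasoning

two-thirds<whole : ∀ W → 0 < W → 2 * W < 3 * W
two-thirds<whole (suc W) _ = *-monoˡ-< (suc W) (n<1+n 2)

min-is-a-third : ∀ a b W → W ≤ 3 * a → W ≤ 3 * b → W ≤ 3 * (a ⊓ b)
min-is-a-third a b W W≤3a W≤3b = subst (W ≤_) (sym (*-distribˡ-⊓ 3 a b)) (⊓-glb W≤3a W≤3b)

crossing-point : ∀ N (P : ℕ → Set) → (∀ j → Dec (P j)) → P 0 → ¬ P N → ∃[ k ] (k < N × P k × ¬ P (suc k))
crossing-point zero P P? P0 ¬PN = contradiction P0 ¬PN
crossing-point (suc N) P P? P0 ¬PN+1 with P? N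
... | yes PN = N , ≤-refl , PN , ¬PN+1
... | no ¬PN with crossing-point N P P? P0 ¬PN
...   | k , k<N , Pk , ¬Pk+1 = k , m<n⇒m<1+n k<N , Pk , ¬Pk+1

module Balanced (m′ n′ : ℕ) (w : Weights (suc m′) (suc n′)) where
  open Grid m′ n′

  W : ℕ
  W = total w

  p : ℕ → ℕ
  p k = weightOf w (Prefix k)

  p-zero : p 0 ≡ 0
  p-zero = weight-empty w (Prefix 0) (λ u → dec-false (below? 0 u) λ ())

  p-all : p N ≡ W
  p-all = weight-full w (Prefix N) (λ u → setOf-intro (below? N) u (rank<N u))

  p-step : ∀ k → p (suc k) ≡ p k + weightOf w (Point k)
  p-step k = weight-split w (Prefix (suc k)) (Prefix k) (Point k) (λ u → split (rank u) k (w u))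
    where
    -- rank r < k + 1 exactly when r < k or r = k.
    split : ∀ r k x → (if does (r <? suc k) then x else 0)
                    ≡ (if does (r <? k) then x else 0) + (if does (r ≟ k) then x else 0)
    split zero zero x = refl
    split zero (suc k) x = sym (+-identityʳ x)
    split (suc r) zero x = refl
    split (suc r) (suc k) x = split r k x

  point-weight : ∀ k (k<N : k < N) → weightOf w (Point k) ≡ w (nodeAt k k<N)
  point-weight k k<N = weight-single w (Point k) (nodeAt k k<N)
    (λ u u∈S → rank-injective u _ (trans (setOf-elim (at? k) u u∈S) (sym (rank-nodeAt k k<N))))
    (setOf-intro (at? k) (nodeAt k k<N) (rank-nodeAt k k<N))

  balanced-bipartition : 2 ≤ m → 2 ≤ n → (∀ v → 2 * w v ≤ W) → 0 < W
                       → ∃[ T ] (ConnectedBipartition T × W ≤ 3 * minWeight w T)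
  balanced-bipartition m≥2 n≥2 light 0<W
    with crossing-point N (λ j → 3 * p j < W) (λ j → 3 * p j <? W)
           (subst (λ x → 3 * x < W) (sym p-zero) 0<W)
           (λ 3pN<W → <⇒≱ (subst (λ x → 3 * x < W) p-all 3pN<W) (m≤m+n W (2 * W)))
  ... | k , k<N , 3pk<W , 3pk+1≮W with 3 * p (suc k) ≤? 2 * W
  ...   | yes 3pk+1≤2W =
    Prefix (suc k) , prefix-bipartition (suc k) z<s k+1<N ,
    min-is-a-third (p (suc k)) (weightOf w (complement (Prefix (suc k)))) W (≮⇒≥ 3pk+1≮W)
      (rest-is-a-third (p (suc k)) _ W (weight-complement w (Prefix (suc k))) 3pk+1≤2W)
    where
    -- The whole grid weighs more than 2W/3, so it is not yet reached.
    k+1<N : suc k < N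
    k+1<N with m≤n⇒m<n∨m≡n k<N
    ... | inj₁ k+1<N = k+1<N
    ... | inj₂ k+1≡N = contradiction (subst (λ x → 3 * x ≤ 2 * W) (trans (cong p k+1≡N) p-all) 3pk+1≤2W)
                                     (<⇒≱ (two-thirds<whole W 0<W))
  ...   | no 3pk+1≰2W =
    Point k , point-bipartition m≥2 n≥2 k k<N ,
    min-is-a-third (weightOf w (Point k)) (weightOf w (complement (Point k))) W heavy rest
    where
    heavy : W ≤ 3 * weightOf w (Point k)
    heavy = jump-is-a-third (p k) _ W 3pk<W (subst (λ x → 2 * W < 3 * x) (p-step k) (≰⇒> 3pk+1≰2W))
    light-point : 2 * weightOf w (Point k) ≤ W
    light-point = subst (λ x → 2 * x ≤ W) (sym (point-weight k k<N)) (light (nodeAt k k<N))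
    rest : W ≤ 3 * weightOf w (complement (Point k))
    rest = rest-is-a-third (weightOf w (Point k)) _ W (weight-complement w (Point k))
             (half⇒two-thirds (weightOf w (Point k)) W light-point)

-- An optimal connected bipartition is at least as balanced as the one
-- constructed above.
lemma11 : (m n : ℕ) → 3 ≤ m → 3 ≤ n → (w : Weights m n)
    → (∀ v → 0 < w v)
    → (∀ v → 2 * w v ≤ total w)
    → (S : Subset m n) → ConnectedBipartition S
    → (∀ T → ConnectedBipartition T → minWeight w T ≤ minWeight w S)
    → total w ≤ 3 * minWeight w S
lemma11 (suc m′) (suc n′) m≥3 n≥3 w _ light S _ optimal with total w ≟ 0
... | yes W≡0 = subst (_≤ 3 * minWeight w S) (sym W≡0) z≤n
... | no W≢0
  with Balanced.balanced-bipartition m′ n′ w (≤-trans (n≤1+n 2) m≥3) (≤-trans (n≤1+n 2) n≥3) light (n≢0⇒n>0 W≢0)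
...   | T , T-bipartition , W≤3minT = ≤-trans W≤3minT (*-monoʳ-≤ 3 (optimal T T-bipartition))
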